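{- Let $n\ge 1$. Fix pairings $\mathcal{B},\mathcal{W}$ of $[2n]$ such that the graph on $[2n]$ with edge set $\mathcal{B}\cup\mathcal{W}$ is connected (i.e. $\mathcal{L}(\mathcal{B},\mathcal{W})$ is a single polygon). Then, as formal linear combinations of unlabeled non-oriented maps, $$\sum_{(\mathcal{B}',\mathcal{W}',\mathcal{E}')}(\mathcal{B}',\mathcal{W}',\mathcal{E}')=(2n-1)!\sum_{\mathcal{E}}(\mathcal{B},\mathcal{W},\mathcal{E}),$$ where the left sum runs over all triples of pairings $\mathcal{B}',\mathcal{W}',\mathcal{E}'$ of $[2n]$ such that $\mathcal{L}(\mathcal{B}',\mathcal{W}')$ is a single polygon, and the right sum runs over all pairings $\mathcal{E}$ of $[2n]$.
   Context: A pairing of a finite set $X$ is a set-partition of $X$ into $2$-element blocks. A non-oriented map is a triple $M=(\mathcal{B},\mathcal{W},\mathcal{E})$ of pairings of the same finite set $X$ (elements of $X$ are called edge-sides). Given pairings $\mathcal{B},\mathcal{W}$ of $X$, $\mathcal{L}(\mathcal{B},\mathcal{W})$ is the bicolored graph with a black vertex for each pair of $\mathcal{B}$, a white vertex for each pair of $\mathcal{W}$, and for each $i\in X$ an edge labeled $i$ joining the pair of $\mathcal{B}$ containing $i$ and the pair of $\mathcal{W}$ containing $i$; it is a disjoint union of polygons. Gluing the polygons along the pairs of $\mathcal{E}$ (identifying black endpoints with black, white with white) yields a bicolored graph embedded in a surface; the polygons are the faces. An unlabeled map is the isomorphism class of $(\mathcal{B},\mathcal{W},\mathcal{E})$ under bijective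 relabelings of $X$ (i.e. $(\mathcal{B},\mathcal{W},\mathcal{E})$ on $X$ and $(\pi(\mathcal{B}),\pi(\mathcal{W}),\pi(\mathcal{E}))$ on $Y$ are identified for any bijection $\pi\colon X\to Y$). -}

module Defs where

open import Data.Bool using (Bool; true; false; _∧_; _∨_; not; T)
open import Data.Nat using (ℕ; zero; suc)
open import Data.Fin using (Fin; _≟_)
open import Data.Fin.Base using ()
open import Data.List using (List; []; _∷_; map; concatMap; filter; length; allFin)
open import Data.Bool.ListAction using (all; any)
open import Data.Vec using (Vec; lookup) renaming ([] to []ᵥ; _∷_ to _∷ᵥ_)
open import Data.Product using (_×_; _,_)
open import Relation.Nullary using (does)
open import Relation.Unary using ()
open import Relation.Nullary.Decidable using (⌊_⌋)

_==_ : ∀ {m} → Fin m → Fin m → Bool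
x == y = ⌊ x ≟ y ⌋

∀F : ∀ {m} → (Fin m → Bool) → Bool
∀F {m} p = all p (allFin m)

∃F : ∀ {m} → (Fin m → Bool) → Bool
∃F {m} p = any p (allFin m)

Endo : ℕ → Set
Endo m = Vec (Fin m) m

allVecs : ∀ {m} (k : ℕ) → List (Vec (Fin m) k)
allVecs zero = []ᵥ ∷ []
allVecs {m} (suc k) = concatMap (λ x → map (x ∷ᵥ_) (allVecs k)) (allFin m)

-- A pairing of X = Fin m (a partition of X into 2-element blocks) is encoded
-- by its partner function p : X → X, p x = the other element of the block
-- containing x, i.e. a fixed-point-free involution.
isPairing : ∀ {m} → Endo m → Bool
isPairing p = ∀F (λ x → (lookup p (lookup p x) == x) ∧ not (lookup p x == x))

pairings : (m : ℕ) → List (Endo m)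
pairings m = filter (λ p → T? (isPairing p)) (allVecs m)
  where
  open import Data.Bool.Properties using () renaming (T? to T?)

-- a (non-oriented) map on Fin m: a triple (B , W , E) of pairings
Triple : ℕ → Set
Triple m = Endo m × Endo m × Endo m

isMap : ∀ {m} → Triple m → Bool
isMap (b , w , e) = isPairing b ∧ isPairing w ∧ isPairing e

maps : (m : ℕ) → List (Triple m)
maps m = concatMap (λ b → concatMap (λ w → map (λ e → b , w , e) (pairings m)) (pairings m)) (pairings m)

-- π is a bijection of Fin m (injective self-map of a finite set)
isPerm : ∀ {m} → Endo m → Bool
isPerm π = ∀F (λ x → ∀F (λ y → not (lookup π x == lookup π y) ∨ (x == y)))

carries : ∀ {m} → Endo m → Endo m → Endo m → Bool
carries π p q = ∀F (λ x → lookup q (lookup π x) == lookup π (lookup p x))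

-- Two maps are isomorphic (define the same unlabeled map) iff some
-- relabeling bijection π carries B to B', W to W' and E to E'.
isoMap : ∀ {m} → Triple m → Triple m → Bool
isoMap {m} (b , w , e) (b' , w' , e') =
  any (λ π → isPerm π ∧ carries π b b' ∧ carries π w w' ∧ carries π e e') (allVecs m)

-- Connectivity of the graph on Fin m with edge set B ∪ W
-- (equivalently L(B,W) is a single polygon).
-- One step of neighbourhood closure of a vertex set S.
step : ∀ {m} → Endo m → Endo m → (Fin m → Bool) → (Fin m → Bool)
step b w S y = S y ∨ ∃F (λ x → S x ∧ ((lookup b x == y) ∨ (lookup w x == y)))

iter : ∀ {A : Set} → ℕ → (A → A) → A → A
iter zero f a = a
iter (suc k) f a = f (iter k f a)

-- vertices reachable from x by a path of length ≤ m (enough: paths need ≤ m-1 edges)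
reachable : ∀ {m} → Endo m → Endo m → Fin m → Fin m → Bool
reachable {m} b w x y = iter m (step b w) (λ z → x == z) y

connected : ∀ {m} → Endo m → Endo m → Bool
connected b w = ∀F (λ x → ∀F (λ y → reachable b w x y))

count : ∀ {A : Set} → (A → Bool) → List A → ℕ
count p [] = 0
count p (x ∷ xs) with p x
... | true = suc (count p xs)
... | false = count p xs

-- Coefficient of the unlabeled map [M] in the left-hand side:
-- number of triples (B',W',E') of pairings of Fin m with L(B',W') a single
-- polygon that are isomorphic to M.
lhsCoeff : ∀ {m} → Triple m → ℕ
lhsCoeff {m} M = count (λ { (b , w , e) → connected b w ∧ isoMap (b , w , e) M }) (maps m)

-- Number of pairings E of Fin m with (B,W,E) isomorphic to M
-- (coefficient of [M] in Σ_E (B,W,E)).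
rhsCount : ∀ {m} → Endo m → Endo m → Triple m → ℕ
rhsCount {m} b w M = count (λ e → isoMap (b , w , e) M) (pairings m)

module Submission where

-- Put N = 2n, fix the single polygon (B , W) and a map M, and
-- count in two ways the pairs (σ , E) of a permutation σ of Fin N and a
-- pairing E with (B , W , E) ≅ M; there are N! · rhsCount of them.
-- Relabelling by σ sends (σ , E) to the rooted map ((σB , σW , σE) , σ 0),
-- whose black/white graph is again a single polygon and which is again
-- isomorphic to M.  Conversely, a single polygon (b , w) with a root x is the
-- image of (B , W , 0) under exactly one relabelling: walk alternately along
-- B and W from 0 and along b and w from x, and match the k-th vertices.  So
-- the pairs (σ , E) are in bijection with the rooted maps counted by
-- N · lhsCoeff, and N · (N-1)! · rhsCount = N · lhsCoeff gives the theorem.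

open import Defs
open import Data.Bool using (Bool; true; false; T; _∧_; _∨_; not; if_then_else_)
open import Data.Bool.Properties using (T-∧; T-∨; T?; ∧-identityʳ; not-injective; not-involutive; not-¬; ¬-not) renaming (_≟_ to _≟ᵇ_)
open import Data.Empty using (⊥; ⊥-elim)
open import Data.Nat using (ℕ; zero; suc; pred; _+_; _*_; _∸_; _≤_; _<_; z≤n; s≤s; _!; _≡ᵇ_)
open import Data.Nat.Properties using (m<n⇒m<1+n; <-irrefl; ≤-antisym; <-trans; <-cmp; ≤-pred; n<1+n; ≤∧≢⇒<; m≤n⇒m<n∨m≡n; *-assoc; *-comm; *-cancelʳ-≡; ≡ᵇ⇒≡; ≡⇒≡ᵇ)
open import Data.Fin using (Fin; _≟_; toℕ; fromℕ<; punchIn; punchOut) renaming (zero to fz; suc to fs)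
open import Data.Fin.Properties using (0≢1+n; any?; pigeonhole; injective⇒≤; toℕ<n; toℕ-fromℕ<; punchIn-injective; punchInᵢ≢i; punchIn-punchOut; punchOut-punchIn; punchOut-cong; punchOut-injective; suc-injective)
open import Data.List using (List; []; _∷_; map; concatMap; length; allFin; _++_; cartesianProduct; cartesianProductWith)
open import Data.List.Properties using (map-++; map-∘; concatMap-cong; length-tabulate)
open import Data.List.Membership.Propositional using (_∈_; lose)
open import Data.List.Membership.Propositional.Properties using (∈-allFin; ∈-filter⁺; ∈-filter⁻; ∈-cartesianProductWith⁺; ∈-cartesianProduct⁺; ∈-cartesianProduct⁻)
open import Data.List.Relation.Unary.All as All using ([]; _∷_)
open import Data.List.Relation.Unary.All.Properties using (all⁺; all⁻)
open import Data.List.Relation.Unary.Any as Any using (here; there)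
open import Data.List.Relation.Unary.Any.Properties using (any⁺; any⁻)
open import Data.List.Relation.Unary.AllPairs using ([]; _∷_)
open import Data.List.Relation.Unary.Unique.Propositional using (Unique)
open import Data.List.Relation.Unary.Unique.Propositional.Properties using (allFin⁺; filter⁺; cartesianProductWith⁺; cartesianProduct⁺)
open import Data.Vec using (Vec; lookup; tabulate) renaming ([] to []ᵥ; _∷_ to _∷ᵥ_; map to mapᵥ)
open import Data.Vec.Properties using (∷-injective; lookup∘tabulate; tabulate∘lookup; tabulate-cong; lookup-map) renaming (≡-dec to ≡-decᵥ)
open import Data.Product using (Σ; ∃; _×_; _,_; proj₁; proj₂)
open import Data.Product.Properties using () renaming (≡-dec to ≡-dec×)
open import Data.Sum using (_⊎_; inj₁; inj₂)
open import Function.Bundles using (Equivalence)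
open import Relation.Nullary using (¬_; yes; no)
open import Relation.Binary using (tri<; tri≈; tri>)
open import Relation.Nullary.Decidable using (⌊_⌋; toWitness; fromWitness; toWitnessFalse; fromWitnessFalse)
open import Relation.Binary.Definitions using (DecidableEquality)
open import Relation.Binary.PropositionalEquality using (_≡_; _≢_; refl; sym; trans; cong; cong₂; subst; module ≡-Reasoning)

∧⁻ : ∀ {a b} → T (a ∧ b) → T a × T b
∧⁻ {a} = Equivalence.to (T-∧ {a})

∧⁺ : ∀ {a b} → T a → T b → T (a ∧ b)
∧⁺ p q = Equivalence.from T-∧ (p , q)

∨⁻ : ∀ {a b} → T (a ∨ b) → T a ⊎ T b
∨⁻ {a} = Equivalence.to (T-∨ {a})

∨⁺ˡ : ∀ {a b} → T a → T (a ∨ b)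
∨⁺ˡ p = Equivalence.from T-∨ (inj₁ p)

∨⁺ʳ : ∀ {a b} → T b → T (a ∨ b)
∨⁺ʳ {a} q = Equivalence.from (T-∨ {a}) (inj₂ q)

==⇒≡ : ∀ {m} {x y : Fin m} → T (x == y) → x ≡ y
==⇒≡ = toWitness

≡⇒== : ∀ {m} {x y : Fin m} → x ≡ y → T (x == y)
≡⇒== = fromWitness

not==⇒≢ : ∀ {m} {x y : Fin m} → T (not (x == y)) → x ≢ y
not==⇒≢ = toWitnessFalse

≢⇒not== : ∀ {m} {x y : Fin m} → x ≢ y → T (not (x == y))
≢⇒not== = fromWitnessFalse

∀F⁻ : ∀ {m} {p : Fin m → Bool} → T (∀F p) → ∀ x → T (p x)
∀F⁻ {m} {p} t x = All.lookup (all⁺ p (allFin m) t) (∈-allFin x)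

∀F⁺ : ∀ {m} {p : Fin m → Bool} → (∀ x → T (p x)) → T (∀F p)
∀F⁺ {m} {p} h = all⁻ p (All.tabulate {xs = allFin m} (λ {x} _ → h x))

∃F⁻ : ∀ {m} {p : Fin m → Bool} → T (∃F p) → ∃ λ x → T (p x)
∃F⁻ {m} {p} t = Any.satisfied (any⁻ p (allFin m) t)

∃F⁺ : ∀ {m} {p : Fin m → Bool} (x : Fin m) → T (p x) → T (∃F p)
∃F⁺ {p = p} x px = any⁺ p (lose (∈-allFin x) px)

-- Counting along lists.

count-ext : ∀ {A : Set} (p q : A → Bool) (xs : List A) →
  (∀ x → x ∈ xs → T (p x) → T (q x)) → (∀ x → x ∈ xs → T (q x) → T (p x)) →
  count p xs ≡ count q xs
count-ext p q [] _ _ = refl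
count-ext p q (x ∷ xs) p⇒q q⇒p with p x in px | q x in qx
... | true  | true  = cong suc (count-ext p q xs (λ y m → p⇒q y (there m)) (λ y m → q⇒p y (there m)))
... | false | false = count-ext p q xs (λ y m → p⇒q y (there m)) (λ y m → q⇒p y (there m))
... | true  | false = ⊥-elim (subst T qx (p⇒q x (here refl) (subst T (sym px) _)))
... | false | true  = ⊥-elim (subst T px (q⇒p x (here refl) (subst T (sym qx) _)))

count-true : ∀ {A : Set} (xs : List A) → count (λ _ → true) xs ≡ length xs
count-true [] = refl
count-true (x ∷ xs) = cong suc (count-true xs)

count-false : ∀ {A : Set} (xs : List A) → count (λ _ → false) xs ≡ 0
count-false [] = refl
count-false (x ∷ xs) = count-false xs

count-++ : ∀ {A : Set} (p : A → Bool) (xs ys : List A) → count p (xs ++ ys) ≡ count p xs + count p ys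
count-++ p [] ys = refl
count-++ p (x ∷ xs) ys with p x
... | true  = cong suc (count-++ p xs ys)
... | false = count-++ p xs ys

count-map : ∀ {A B : Set} (p : B → Bool) (f : A → B) (xs : List A) → count p (map f xs) ≡ count (λ x → p (f x)) xs
count-map p f [] = refl
count-map p f (x ∷ xs) with p (f x)
... | true  = cong suc (count-map p f xs)
... | false = count-map p f xs

count-cartesianProductWith-const : ∀ {A B C : Set} (p : C → Bool) (f : A → B → C) (xs : List A) (ys : List B) (c : ℕ) →
  (∀ x → x ∈ xs → count (λ y → p (f x y)) ys ≡ c) → count p (cartesianProductWith f xs ys) ≡ length xs * c
count-cartesianProductWith-const p f [] ys c rows = refl
count-cartesianProductWith-const p f (x ∷ xs) ys c rows = begin
  count p (map (f x) ys ++ cartesianProductWith f xs ys)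
    ≡⟨ count-++ p (map (f x) ys) _ ⟩
  count p (map (f x) ys) + count p (cartesianProductWith f xs ys)
    ≡⟨ cong₂ _+_ (trans (count-map p (f x) ys) (rows x (here refl)))
                 (count-cartesianProductWith-const p f xs ys c (λ y m → rows y (there m))) ⟩
  c + length xs * c ∎
  where open ≡-Reasoning

count-cartesianProduct : ∀ {A B : Set} (P : A → Bool) (Q : B → Bool) (xs : List A) (ys : List B) →
  count (λ z → P (proj₁ z) ∧ Q (proj₂ z)) (cartesianProduct xs ys) ≡ count P xs * count Q ys
count-cartesianProduct P Q [] ys = refl
count-cartesianProduct P Q (x ∷ xs) ys = begin
  count R (cartesianProduct (x ∷ xs) ys)
    ≡⟨ count-++ R (map (x ,_) ys) (cartesianProduct xs ys) ⟩
  count R (map (x ,_) ys) + count R (cartesianProduct xs ys)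
    ≡⟨ cong₂ _+_ (count-map R (x ,_) ys) (count-cartesianProduct P Q xs ys) ⟩
  count (λ y → P x ∧ Q y) ys + count P xs * count Q ys
    ≡⟨ first-row ⟩
  count P (x ∷ xs) * count Q ys ∎
  where
  open ≡-Reasoning
  R : _ → Bool
  R z = P (proj₁ z) ∧ Q (proj₂ z)
  first-row : count (λ y → P x ∧ Q y) ys + count P xs * count Q ys ≡ count P (x ∷ xs) * count Q ys
  first-row with P x
  ... | true  = refl
  ... | false = cong (_+ (count P xs * count Q ys)) (count-false ys)

count-cartesianProductˡ : ∀ {A B : Set} (P : A → Bool) (xs : List A) (ys : List B) →
  count (λ z → P (proj₁ z)) (cartesianProduct xs ys) ≡ count P xs * length ys
count-cartesianProductˡ P xs ys = begin
  count (λ z → P (proj₁ z)) (cartesianProduct xs ys)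
    ≡⟨ count-ext _ _ (cartesianProduct xs ys)
         (λ z _ t → subst T (sym (∧-identityʳ (P (proj₁ z)))) t)
         (λ z _ t → subst T (∧-identityʳ (P (proj₁ z))) t) ⟩
  count (λ z → P (proj₁ z) ∧ true) (cartesianProduct xs ys)
    ≡⟨ count-cartesianProduct P (λ _ → true) xs ys ⟩
  count P xs * count (λ _ → true) ys
    ≡⟨ cong (count P xs *_) (count-true ys) ⟩
  count P xs * length ys ∎
  where open ≡-Reasoning

module _ {B : Set} (_≟B_ : DecidableEquality B) where

  without : (B → Bool) → B → B → Bool
  without q c y = q y ∧ not ⌊ y ≟B c ⌋

  count-without : (q : B → Bool) (ys : List B) → Unique ys → ∀ {c} → c ∈ ys → T (q c) →
    count q ys ≡ suc (count (without q c) ys)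
  count-without q (y ∷ ys) (y∉ys ∷ _) (here refl) qy with q y
  ... | true with y ≟B y
  ...   | no y≢y = ⊥-elim (y≢y refl)
  ...   | yes _  = cong suc (count-ext q (without q y) ys
            (λ z z∈ys qz → ∧⁺ qz (fromWitnessFalse (λ z≡y → All.lookup y∉ys z∈ys (sym z≡y))))
            (λ z _ t → proj₁ (∧⁻ t)))
  count-without q (y ∷ ys) (y∉ys ∷ u) {c} (there c∈ys) qc with y ≟B c
  ... | yes refl = ⊥-elim (All.lookup y∉ys c∈ys refl)
  ... | no _ with q y
  ...   | true  = cong suc (count-without q ys u c∈ys qc)
  ...   | false = count-without q ys u c∈ys qc

  count-injection : ∀ {A : Set} (p : A → Bool) (q : B → Bool) (xs : List A) (ys : List B) →
    Unique xs → Unique ys → (f : A → B) →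
    (∀ a → a ∈ xs → T (p a) → f a ∈ ys × T (q (f a))) →
    (∀ a a' → a ∈ xs → a' ∈ xs → T (p a) → T (p a') → f a ≡ f a' → a ≡ a') →
    count p xs ≤ count q ys
  count-injection p q [] ys _ _ f maps-to inj = z≤n
  count-injection p q (x ∷ xs) ys (x∉xs ∷ ux) uy f maps-to inj with p x in px
  ... | false = count-injection p q xs ys ux uy f (λ a m → maps-to a (there m))
                  (λ a a' m m' → inj a a' (there m) (there m'))
  ... | true = subst (suc (count p xs) ≤_) (sym (count-without q ys uy fx∈ys qfx)) (s≤s rest)
    where
    pxT : T (p x)
    pxT = subst T (sym px) _
    fx∈ys : f x ∈ ys
    fx∈ys = proj₁ (maps-to x (here refl) pxT)
    qfx : T (q (f x))
    qfx = proj₂ (maps-to x (here refl) pxT)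
    avoids-fx : ∀ a → a ∈ xs → T (p a) → T (without q (f x) (f a))
    avoids-fx a m pa = ∧⁺ (proj₂ (maps-to a (there m) pa))
      (fromWitnessFalse (λ fa≡fx → All.lookup x∉xs m (sym (inj a x (there m) (here refl) pa pxT fa≡fx))))
    rest : count p xs ≤ count (without q (f x)) ys
    rest = count-injection p (without q (f x)) xs ys ux uy f
             (λ a m pa → proj₁ (maps-to a (there m) pa) , avoids-fx a m pa)
             (λ a a' m m' → inj a a' (there m) (there m'))

count-bijection : ∀ {A B : Set} → DecidableEquality A → DecidableEquality B →
  (p : A → Bool) (q : B → Bool) (xs : List A) (ys : List B) → Unique xs → Unique ys →
  (f : A → B) (g : B → A) →
  (∀ a → a ∈ xs → T (p a) → f a ∈ ys × T (q (f a))) →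
  (∀ b → b ∈ ys → T (q b) → g b ∈ xs × T (p (g b))) →
  (∀ a → a ∈ xs → T (p a) → g (f a) ≡ a) →
  (∀ b → b ∈ ys → T (q b) → f (g b) ≡ b) →
  count p xs ≡ count q ys
count-bijection _≟A_ _≟B_ p q xs ys ux uy f g f-to g-to gf fg = ≤-antisym
  (count-injection _≟B_ p q xs ys ux uy f f-to
    (λ a a' m m' pa pa' e → trans (sym (gf a m pa)) (trans (cong g e) (gf a' m' pa'))))
  (count-injection _≟A_ q p ys xs uy ux g g-to
    (λ b b' m m' qb qb' e → trans (sym (fg b m qb)) (trans (cong f e) (fg b' m' qb'))))

-- Enumerations.  The lists of Defs are cartesian products in disguise, which
-- gives their membership and duplicate-freeness from the library.

concatMap-rows : ∀ {A B C : Set} (f : A → B → C) (xs : List A) (ys : List B) →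
  concatMap (λ x → map (f x) ys) xs ≡ cartesianProductWith f xs ys
concatMap-rows f [] ys = refl
concatMap-rows f (x ∷ xs) ys = cong (map (f x) ys ++_) (concatMap-rows f xs ys)

map-cartesianProductWith : ∀ {A B C D : Set} (g : C → D) (f : A → B → C) (xs : List A) (ys : List B) →
  map g (cartesianProductWith f xs ys) ≡ cartesianProductWith (λ x y → g (f x y)) xs ys
map-cartesianProductWith g f [] ys = refl
map-cartesianProductWith g f (x ∷ xs) ys = begin
  map g (map (f x) ys ++ cartesianProductWith f xs ys)
    ≡⟨ map-++ g (map (f x) ys) _ ⟩
  map g (map (f x) ys) ++ map g (cartesianProductWith f xs ys)
    ≡⟨ cong₂ _++_ (sym (map-∘ ys)) (map-cartesianProductWith g f xs ys) ⟩
  map (λ y → g (f x y)) ys ++ cartesianProductWith (λ x y → g (f x y)) xs ys ∎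
  where open ≡-Reasoning

allVecs-rows : ∀ {m} k → allVecs {m} (suc k) ≡ cartesianProductWith _∷ᵥ_ (allFin m) (allVecs k)
allVecs-rows {m} k = concatMap-rows _∷ᵥ_ (allFin m) (allVecs k)

allVecs-unique : ∀ {m} k → Unique (allVecs {m} k)
allVecs-unique zero = [] ∷ []
allVecs-unique {m} (suc k) = subst Unique (sym (allVecs-rows k))
  (cartesianProductWith⁺ _∷ᵥ_ ∷-injective (allFin⁺ m) (allVecs-unique k))

allVecs-complete : ∀ {m k} (v : Vec (Fin m) k) → v ∈ allVecs k
allVecs-complete []ᵥ = here refl
allVecs-complete {m} (x ∷ᵥ v) = subst (_ ∈_) (sym (allVecs-rows _))
  (∈-cartesianProductWith⁺ _∷ᵥ_ (∈-allFin x) (allVecs-complete v))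

record Pairing {m} (p : Endo m) : Set where
  constructor pairing
  field
    involutive    : ∀ x → lookup p (lookup p x) ≡ x
    fixpoint-free : ∀ x → lookup p x ≢ x

pairing⁻ : ∀ {m} {p : Endo m} → T (isPairing p) → Pairing p
pairing⁻ t = pairing (λ x → ==⇒≡ (proj₁ (∧⁻ (∀F⁻ t x)))) (λ x → not==⇒≢ (proj₂ (∧⁻ (∀F⁻ t x))))

pairing⁺ : ∀ {m} {p : Endo m} → Pairing p → T (isPairing p)
pairing⁺ (pairing invol no-fix) = ∀F⁺ (λ x → ∧⁺ (≡⇒== (invol x)) (≢⇒not== (no-fix x)))

pairings-unique : ∀ m → Unique (pairings m)
pairings-unique m = filter⁺ (λ p → T? (isPairing p)) (allVecs-unique m)

∈-pairings⁺ : ∀ {m} {p : Endo m} → Pairing p → p ∈ pairings m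
∈-pairings⁺ {p = p} pp = ∈-filter⁺ (λ p → T? (isPairing p)) (allVecs-complete p) (pairing⁺ pp)

∈-pairings⁻ : ∀ {m} {p : Endo m} → p ∈ pairings m → Pairing p
∈-pairings⁻ {m} mem = pairing⁻ (proj₂ (∈-filter⁻ (λ p → T? (isPairing p)) {xs = allVecs m} mem))

maps-rows : ∀ m → maps m ≡ cartesianProduct (pairings m) (cartesianProduct (pairings m) (pairings m))
maps-rows m = begin
  maps m
    ≡⟨ concatMap-cong (λ b → trans (concatMap-rows (λ w e → b , w , e) P P)
                                   (sym (map-cartesianProductWith (b ,_) _,_ P P))) P ⟩
  concatMap (λ b → map (b ,_) (cartesianProduct P P)) P
    ≡⟨ concatMap-rows _,_ P (cartesianProduct P P) ⟩
  cartesianProduct P (cartesianProduct P P) ∎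
  where
  open ≡-Reasoning
  P : List (Endo m)
  P = pairings m

maps-unique : ∀ m → Unique (maps m)
maps-unique m = subst Unique (sym (maps-rows m))
  (cartesianProduct⁺ (pairings-unique m) (cartesianProduct⁺ (pairings-unique m) (pairings-unique m)))

∈-maps⁺ : ∀ {m} {b w e : Endo m} → Pairing b → Pairing w → Pairing e → (b , w , e) ∈ maps m
∈-maps⁺ {m} pb pw pe = subst (_ ∈_) (sym (maps-rows m))
  (∈-cartesianProduct⁺ (∈-pairings⁺ pb) (∈-cartesianProduct⁺ (∈-pairings⁺ pw) (∈-pairings⁺ pe)))

∈-maps⁻ : ∀ {m} {b w e : Endo m} → (b , w , e) ∈ maps m → Pairing b × Pairing w × Pairing e
∈-maps⁻ {m} mem with ∈-cartesianProduct⁻ (pairings m) _ (subst (_ ∈_) (maps-rows m) mem)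
... | b∈P , we∈PP with ∈-cartesianProduct⁻ (pairings m) (pairings m) we∈PP
...   | w∈P , e∈P = ∈-pairings⁻ b∈P , ∈-pairings⁻ w∈P , ∈-pairings⁻ e∈P

-- Injective tuples and permutations.

vec-ext : ∀ {A : Set} {k} {u v : Vec A k} → (∀ i → lookup u i ≡ lookup v i) → u ≡ v
vec-ext {u = u} {v} h = trans (sym (tabulate∘lookup u)) (trans (tabulate-cong h) (tabulate∘lookup v))

Inj : ∀ {m k} → Vec (Fin m) k → Set
Inj v = ∀ i j → lookup v i ≡ lookup v j → i ≡ j

-- The test isPerm of Defs, for tuples of any length.
isInjective : ∀ {m k} → Vec (Fin m) k → Bool
isInjective v = ∀F (λ x → ∀F (λ y → not (lookup v x == lookup v y) ∨ (x == y)))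

injective⁻ : ∀ {m k} (v : Vec (Fin m) k) → T (isInjective v) → Inj v
injective⁻ v t i j e with ∨⁻ (∀F⁻ (∀F⁻ t i) j)
... | inj₁ differ = ⊥-elim (not==⇒≢ differ e)
... | inj₂ same   = ==⇒≡ same

injective⁺ : ∀ {m k} (v : Vec (Fin m) k) → Inj v → T (isInjective v)
injective⁺ v inj = ∀F⁺ (λ i → ∀F⁺ (λ j → test i j))
  where
  test : ∀ i j → T (not (lookup v i == lookup v j) ∨ (i == j))
  test i j with lookup v i ≟ lookup v j
  ... | yes e = ≡⇒== (inj i j e)
  ... | no _  = _

Inj-∷⁻ : ∀ {m k} {x : Fin m} {v : Vec (Fin m) k} → Inj (x ∷ᵥ v) → (∀ i → lookup v i ≢ x) × Inj v
Inj-∷⁻ inj = (λ i e → 0≢1+n (inj fz (fs i) (sym e))) , (λ i j e → suc-injective (inj (fs i) (fs j) e))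

Inj-∷⁺ : ∀ {m k} {x : Fin m} {v : Vec (Fin m) k} → (∀ i → lookup v i ≢ x) → Inj v → Inj (x ∷ᵥ v)
Inj-∷⁺ avoids inj fz     fz     e = refl
Inj-∷⁺ avoids inj fz     (fs j) e = ⊥-elim (avoids j (sym e))
Inj-∷⁺ avoids inj (fs i) fz     e = ⊥-elim (avoids i e)
Inj-∷⁺ avoids inj (fs i) (fs j) e = cong fs (inj i j e)

-- Number of injective k-tuples over Fin m (the falling factorial m!/(m-k)!).
injections : ℕ → ℕ → ℕ
injections m k = count (isInjective {m} {k}) (allVecs k)

-- Deleting the point x from Fin (2+m): a left inverse of punchIn x
-- (x itself is sent anywhere).
squeeze : ∀ {m} → Fin (suc (suc m)) → Fin (suc (suc m)) → Fin (suc m)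
squeeze x y with x ≟ y
... | yes _   = fz
... | no x≢y = punchOut x≢y

squeeze-punchIn : ∀ {m} (x : Fin (suc (suc m))) (z : Fin (suc m)) → squeeze x (punchIn x z) ≡ z
squeeze-punchIn x z with x ≟ punchIn x z
... | yes e = ⊥-elim (punchInᵢ≢i x z (sym e))
... | no _  = trans (punchOut-cong x refl) (punchOut-punchIn x)

punchIn-squeeze : ∀ {m} (x y : Fin (suc (suc m))) → x ≢ y → punchIn x (squeeze x y) ≡ y
punchIn-squeeze x y x≢y with x ≟ y
... | yes e = ⊥-elim (x≢y e)
... | no x≢y′ = punchIn-punchOut x≢y′

-- Injective tuples over Fin (2+m) avoiding x correspond to injective tuples
-- over Fin (1+m), by squeezing x out.
injections-avoiding : ∀ m k (x : Fin (suc (suc m))) →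
  count (λ v → isInjective (x ∷ᵥ v)) (allVecs k) ≡ injections (suc m) k
injections-avoiding m k x = count-bijection (≡-decᵥ _≟_) (≡-decᵥ _≟_) (λ v → isInjective (x ∷ᵥ v)) isInjective (allVecs k) (allVecs k)
  (allVecs-unique k) (allVecs-unique k) squeezeᵥ punchInᵥ
  (λ v _ t → allVecs-complete (squeezeᵥ v) , injective⁺ (squeezeᵥ v) (squeeze-inj v (injective⁻ (x ∷ᵥ v) t)))
  (λ u _ t → allVecs-complete (punchInᵥ u) ,
             injective⁺ (x ∷ᵥ punchInᵥ u) (Inj-∷⁺ (punchIn-avoids u) (punchIn-inj u (injective⁻ u t))))
  (λ v _ t → punchIn-squeezeᵥ v (proj₁ (Inj-∷⁻ (injective⁻ (x ∷ᵥ v) t))))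
  (λ u _ _ → squeeze-punchInᵥ u)
  where
  squeezeᵥ : Vec (Fin (suc (suc m))) k → Vec (Fin (suc m)) k
  squeezeᵥ = mapᵥ (squeeze x)
  punchInᵥ : Vec (Fin (suc m)) k → Vec (Fin (suc (suc m))) k
  punchInᵥ = mapᵥ (punchIn x)
  squeeze-inj : ∀ v → Inj (x ∷ᵥ v) → Inj (squeezeᵥ v)
  squeeze-inj v inj i j e = proj₂ (Inj-∷⁻ inj) i j (begin
    lookup v i                           ≡⟨ sym (punchIn-squeeze x _ (λ e′ → avoids i (sym e′))) ⟩
    punchIn x (squeeze x (lookup v i))   ≡⟨ cong (punchIn x) (trans (sym (lookup-map i (squeeze x) v)) (trans e (lookup-map j (squeeze x) v))) ⟩
    punchIn x (squeeze x (lookup v j))   ≡⟨ punchIn-squeeze x _ (λ e′ → avoids j (sym e′)) ⟩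
    lookup v j                           ∎)
    where
    open ≡-Reasoning
    avoids : ∀ i → lookup v i ≢ x
    avoids = proj₁ (Inj-∷⁻ inj)
  punchIn-avoids : ∀ u i → lookup (punchInᵥ u) i ≢ x
  punchIn-avoids u i e = punchInᵢ≢i x (lookup u i) (trans (sym (lookup-map i (punchIn x) u)) e)
  punchIn-inj : ∀ u → Inj u → Inj (punchInᵥ u)
  punchIn-inj u inj i j e = inj i j (punchIn-injective x _ _
    (trans (sym (lookup-map i (punchIn x) u)) (trans e (lookup-map j (punchIn x) u))))
  punchIn-squeezeᵥ : ∀ v → (∀ i → lookup v i ≢ x) → punchInᵥ (squeezeᵥ v) ≡ v
  punchIn-squeezeᵥ v avoids = vec-ext (λ i → trans (lookup-map i (punchIn x) (squeezeᵥ v))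
    (trans (cong (punchIn x) (lookup-map i (squeeze x) v)) (punchIn-squeeze x _ (λ e → avoids i (sym e)))))
  squeeze-punchInᵥ : ∀ u → squeezeᵥ (punchInᵥ u) ≡ u
  squeeze-punchInᵥ u = vec-ext (λ i → trans (lookup-map i (squeeze x) (punchInᵥ u))
    (trans (cong (squeeze x) (lookup-map i (punchIn x) u)) (squeeze-punchIn x _)))

-- Choosing the first entry, then an injective tuple avoiding it.
injections-step : ∀ m k → injections (suc (suc m)) (suc k) ≡ suc (suc m) * injections (suc m) k
injections-step m k = begin
  injections (suc (suc m)) (suc k)
    ≡⟨ cong (count isInjective) (allVecs-rows {suc (suc m)} k) ⟩
  count isInjective (cartesianProductWith _∷ᵥ_ (allFin (suc (suc m))) (allVecs k))
    ≡⟨ count-cartesianProductWith-const isInjective _∷ᵥ_ (allFin _) (allVecs k) _ (λ x _ → injections-avoiding m k x) ⟩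
  length (allFin (suc (suc m))) * injections (suc m) k
    ≡⟨ cong (_* injections (suc m) k) (length-tabulate {n = suc (suc m)} (λ x → x)) ⟩
  suc (suc m) * injections (suc m) k ∎
  where open ≡-Reasoning

permutations-count : ∀ m → count isPerm (allVecs {m} m) ≡ m !
permutations-count zero          = refl
permutations-count (suc zero)    = refl
permutations-count (suc (suc m)) =
  trans (injections-step m (suc m)) (cong (suc (suc m) *_) (permutations-count (suc m)))

-- Relabelling along permutations.

Carries : ∀ {m} → Endo m → Endo m → Endo m → Set
Carries π p q = ∀ x → lookup q (lookup π x) ≡ lookup π (lookup p x)

Iso : ∀ {m} → Triple m → Triple m → Set
Iso {m} (b , w , e) (b′ , w′ , e′) =
  Σ (Endo m) λ π → Inj π × Carries π b b′ × Carries π w w′ × Carries π e e′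

carries⁻ : ∀ {m} (π p q : Endo m) → T (carries π p q) → Carries π p q
carries⁻ π p q t x = ==⇒≡ (∀F⁻ t x)

carries⁺ : ∀ {m} (π p q : Endo m) → Carries π p q → T (carries π p q)
carries⁺ π p q c = ∀F⁺ (λ x → ≡⇒== (c x))

iso⁻ : ∀ {m} (M M′ : Triple m) → T (isoMap M M′) → Iso M M′
iso⁻ {m} (b , w , e) (b′ , w′ , e′) t with Any.satisfied (any⁻ _ (allVecs m) t)
... | π , ok with ∧⁻ {isPerm π} ok
...   | perm , ok₁ with ∧⁻ {carries π b b′} ok₁
...     | cb , ok₂ with ∧⁻ {carries π w w′} ok₂
...       | cw , ce = π , injective⁻ π perm , carries⁻ π b b′ cb , carries⁻ π w w′ cw , carries⁻ π e e′ ce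

iso⁺ : ∀ {m} (M M′ : Triple m) → Iso M M′ → T (isoMap M M′)
iso⁺ {m} (b , w , e) (b′ , w′ , e′) (π , inj , cb , cw , ce) =
  any⁺ _ (lose (allVecs-complete π)
    (∧⁺ (injective⁺ π inj) (∧⁺ (carries⁺ π b b′ cb) (∧⁺ (carries⁺ π w w′ cw) (carries⁺ π e e′ ce)))))

onto : ∀ {m} (σ : Endo m) → Inj σ → ∀ y → ∃ λ x → lookup σ x ≡ y
onto {suc m} σ inj y with any? (λ x → lookup σ x ≟ y)
... | yes hit = hit
... | no miss = ⊥-elim (<-irrefl refl (injective⇒≤ squeezed-inj))
  where
  squeezed : Fin (suc m) → Fin m
  squeezed x = punchOut {i = y} (λ e → miss (x , sym e))
  squeezed-inj : ∀ {x x′} → squeezed x ≡ squeezed x′ → x ≡ x′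
  squeezed-inj {x} {x′} e = inj x x′ (punchOut-injective (λ e′ → miss (x , sym e′)) (λ e′ → miss (x′ , sym e′)) e)

-- The inverse of an injective σ (defined everywhere; only meaningful for injective σ).
inv : ∀ {m} → Endo m → Fin m → Fin m
inv σ y with any? (λ x → lookup σ x ≟ y)
... | yes (x , _) = x
... | no _        = y

inv-right : ∀ {m} (σ : Endo m) → Inj σ → ∀ y → lookup σ (inv σ y) ≡ y
inv-right σ inj y with any? (λ x → lookup σ x ≟ y)
... | yes (x , e) = e
... | no miss     = ⊥-elim (miss (onto σ inj y))

inv-left : ∀ {m} (σ : Endo m) → Inj σ → ∀ x → inv σ (lookup σ x) ≡ x
inv-left σ inj x = inj _ _ (inv-right σ inj (lookup σ x))

inverse : ∀ {m} → Endo m → Endo m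
inverse σ = tabulate (inv σ)

inverse-inj : ∀ {m} (σ : Endo m) → Inj σ → Inj (inverse σ)
inverse-inj σ inj y y′ e = begin
  y                       ≡⟨ sym (inv-right σ inj y) ⟩
  lookup σ (inv σ y)      ≡⟨ cong (lookup σ) (trans (sym (lookup∘tabulate (inv σ) y)) (trans e (lookup∘tabulate (inv σ) y′))) ⟩
  lookup σ (inv σ y′)     ≡⟨ inv-right σ inj y′ ⟩
  y′                      ∎
  where open ≡-Reasoning

carries-inverse : ∀ {m} (σ p q : Endo m) → Inj σ → Carries σ p q → Carries (inverse σ) q p
carries-inverse σ p q inj c y with onto σ inj y
... | x , refl = begin
  lookup p (lookup (inverse σ) (lookup σ x))   ≡⟨ cong (lookup p) (trans (lookup∘tabulate (inv σ) _) (inv-left σ inj x)) ⟩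
  lookup p x                                   ≡⟨ sym (inv-left σ inj _) ⟩
  inv σ (lookup σ (lookup p x))                ≡⟨ cong (inv σ) (sym (c x)) ⟩
  inv σ (lookup q (lookup σ x))                ≡⟨ sym (lookup∘tabulate (inv σ) _) ⟩
  lookup (inverse σ) (lookup q (lookup σ x))   ∎
  where open ≡-Reasoning

compose : ∀ {m} → Endo m → Endo m → Endo m
compose π σ = tabulate (λ x → lookup π (lookup σ x))

compose-inj : ∀ {m} (π σ : Endo m) → Inj π → Inj σ → Inj (compose π σ)
compose-inj π σ injπ injσ x y e = injσ _ _ (injπ _ _
  (trans (sym (lookup∘tabulate _ x)) (trans e (lookup∘tabulate _ y))))

compose-carries : ∀ {m} (π σ p q r : Endo m) → Carries σ p q → Carries π q r → Carries (compose π σ) p r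
compose-carries π σ p q r cσ cπ x = begin
  lookup r (lookup (compose π σ) x)     ≡⟨ cong (lookup r) (lookup∘tabulate _ x) ⟩
  lookup r (lookup π (lookup σ x))      ≡⟨ cπ (lookup σ x) ⟩
  lookup π (lookup q (lookup σ x))      ≡⟨ cong (lookup π) (cσ x) ⟩
  lookup π (lookup σ (lookup p x))      ≡⟨ sym (lookup∘tabulate _ (lookup p x)) ⟩
  lookup (compose π σ) (lookup p x)     ∎
  where open ≡-Reasoning

iso-sym : ∀ {m} (M M′ : Triple m) → Iso M M′ → Iso M′ M
iso-sym (b , w , e) (b′ , w′ , e′) (π , inj , cb , cw , ce) =
  inverse π , inverse-inj π inj , carries-inverse π b b′ inj cb ,
  carries-inverse π w w′ inj cw , carries-inverse π e e′ inj ce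

iso-trans : ∀ {m} (M M′ M″ : Triple m) → Iso M M′ → Iso M′ M″ → Iso M M″
iso-trans (b , w , e) (b′ , w′ , e′) (b″ , w″ , e″) (σ , injσ , cb , cw , ce) (π , injπ , db , dw , de) =
  compose π σ , compose-inj π σ injπ injσ , compose-carries π σ b b′ b″ cb db ,
  compose-carries π σ w w′ w″ cw dw , compose-carries π σ e e′ e″ ce de

relabel : ∀ {m} → Endo m → Endo m → Endo m
relabel σ p = tabulate (λ y → lookup σ (lookup p (inv σ y)))

relabel-carries : ∀ {m} (σ p : Endo m) → Inj σ → Carries σ p (relabel σ p)
relabel-carries σ p inj x = trans (lookup∘tabulate _ (lookup σ x)) (cong (λ z → lookup σ (lookup p z)) (inv-left σ inj x))

relabel-unique : ∀ {m} (σ p q : Endo m) → Inj σ → Carries σ p q → relabel σ p ≡ q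
relabel-unique σ p q inj c = vec-ext (λ y →
  trans (lookup∘tabulate _ y) (trans (sym (c (inv σ y))) (cong (lookup q) (inv-right σ inj y))))

pullback : ∀ {m} → Endo m → Endo m → Endo m
pullback ρ q = tabulate (λ z → inv ρ (lookup q (lookup ρ z)))

pullback-carries : ∀ {m} (ρ q : Endo m) → Inj ρ → Carries ρ (pullback ρ q) q
pullback-carries ρ q inj z = sym (trans (cong (lookup ρ) (lookup∘tabulate _ z)) (inv-right ρ inj _))

pullback-unique : ∀ {m} (ρ p q : Endo m) → Inj ρ → Carries ρ p q → pullback ρ q ≡ p
pullback-unique ρ p q inj c = vec-ext (λ z →
  trans (lookup∘tabulate _ z) (trans (cong (inv ρ) (c z)) (inv-left ρ inj (lookup p z))))

pairing-pullback : ∀ {m} (ρ p q : Endo m) → Inj ρ → Carries ρ p q → Pairing q → Pairing p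
pairing-pullback ρ p q inj c (pairing invol no-fix) = pairing
  (λ y → inj _ _ (begin
     lookup ρ (lookup p (lookup p y))   ≡⟨ sym (c (lookup p y)) ⟩
     lookup q (lookup ρ (lookup p y))   ≡⟨ cong (lookup q) (sym (c y)) ⟩
     lookup q (lookup q (lookup ρ y))   ≡⟨ invol (lookup ρ y) ⟩
     lookup ρ y                         ∎))
  (λ y e → no-fix (lookup ρ y) (trans (c y) (cong (lookup ρ) e)))
  where open ≡-Reasoning

pairing-push : ∀ {m} (σ p q : Endo m) → Inj σ → Carries σ p q → Pairing p → Pairing q
pairing-push σ p q inj c = pairing-pullback (inverse σ) q p (inverse-inj σ inj) (carries-inverse σ p q inj c)

reach-relabel : ∀ {m} (σ b w b′ w′ : Endo m) → Carries σ b b′ → Carries σ w w′ → ∀ t x y →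
  T (iter t (step b w) (x ==_) y) → T (iter t (step b′ w′) (lookup σ x ==_) (lookup σ y))
reach-relabel σ b w b′ w′ cb cw zero x y x=y = ≡⇒== (cong (lookup σ) (==⇒≡ x=y))
reach-relabel σ b w b′ w′ cb cw (suc t) x y reached with ∨⁻ reached
... | inj₁ before = ∨⁺ˡ (reach-relabel σ b w b′ w′ cb cw t x y before)
... | inj₂ via with ∃F⁻ via
...   | v , reached-v-edge = ∨⁺ʳ (∃F⁺ (lookup σ v) (∧⁺ (reach-relabel σ b w b′ w′ cb cw t x v (proj₁ (∧⁻ reached-v-edge))) edge′))
  where
  edge′ : T ((lookup b′ (lookup σ v) == lookup σ y) ∨ (lookup w′ (lookup σ v) == lookup σ y))
  edge′ with ∨⁻ (proj₂ (∧⁻ reached-v-edge))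
  ... | inj₁ e = ∨⁺ˡ (≡⇒== (trans (cb v) (cong (lookup σ) (==⇒≡ e))))
  ... | inj₂ e = ∨⁺ʳ (≡⇒== (trans (cw v) (cong (lookup σ) (==⇒≡ e))))

connected-relabel : ∀ {m} (σ b w b′ w′ : Endo m) → Inj σ → Carries σ b b′ → Carries σ w w′ →
  T (connected b w) → T (connected b′ w′)
connected-relabel {m} σ b w b′ w′ inj cb cw conn = ∀F⁺ (λ x′ → ∀F⁺ (λ y′ → reach x′ y′))
  where
  reach : ∀ x′ y′ → T (reachable b′ w′ x′ y′)
  reach x′ y′ with onto σ inj x′ | onto σ inj y′
  ... | x , refl | y , refl = reach-relabel σ b w b′ w′ cb cw m x y (∀F⁻ (∀F⁻ conn x) y)

-- The alternating walk around a single polygon.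

-- The step out of an even position of a walk follows b, out of an odd one w.
even : ℕ → Bool
even zero    = true
even (suc k) = not (even k)

stepAt : ∀ {m} → Endo m → Endo m → ℕ → Endo m
stepAt b w k = if even k then b else w

walk : ∀ {m} → Endo m → Endo m → Fin m → ℕ → Fin m
walk b w s zero    = s
walk b w s (suc k) = lookup (stepAt b w k) (walk b w s k)

walk-relabel : ∀ {m} (σ b w b′ w′ : Endo m) → Carries σ b b′ → Carries σ w w′ → ∀ s k →
  walk b′ w′ (lookup σ s) k ≡ lookup σ (walk b w s k)
walk-relabel σ b w b′ w′ cb cw s zero    = refl
walk-relabel σ b w b′ w′ cb cw s (suc k) = begin
  lookup (stepAt b′ w′ k) (walk b′ w′ (lookup σ s) k) ≡⟨ cong (lookup (stepAt b′ w′ k)) (walk-relabel σ b w b′ w′ cb cw s k) ⟩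
  lookup (stepAt b′ w′ k) (lookup σ (walk b w s k))   ≡⟨ step-carried (even k) (walk b w s k) ⟩
  lookup σ (lookup (stepAt b w k) (walk b w s k))     ∎
  where
  open ≡-Reasoning
  step-carried : ∀ c → Carries σ (if c then b else w) (if c then b′ else w′)
  step-carried true  = cb
  step-carried false = cw

-- On a walk closing up after n steps, the b-neighbour of position k is at
-- position bIndex k (even positions step forward, odd ones back) and the
-- w-neighbour at position wIndex n k (even positions step back, odd ones
-- forward, both cyclically modulo n).
bIndex : ℕ → ℕ
bIndex k = if even k then suc k else pred k

cyclicPred : ℕ → ℕ → ℕ
cyclicPred n zero    = pred n
cyclicPred n (suc k) = k

cyclicSuc : ℕ → ℕ → ℕ
cyclicSuc n k = if suc k ≡ᵇ n then 0 else suc k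

wIndex : ℕ → ℕ → ℕ
wIndex n k = if even k then cyclicPred n k else cyclicSuc n k

record Polygon {m} (b w : Endo m) (s : Fin m) : Set where
  field
    cover    : ∀ y → ∃ λ k → k < m × walk b w s k ≡ y
    distinct : ∀ i j → i < m → j < m → walk b w s i ≡ walk b w s j → i ≡ j
    b-move   : ∀ k → k < m → bIndex k < m × lookup b (walk b w s k) ≡ walk b w s (bIndex k)
    w-move   : ∀ k → k < m → wIndex m k < m × lookup w (walk b w s k) ≡ walk b w s (wIndex m k)

module Walk {m} {b w : Endo m} (pb : Pairing b) (pw : Pairing w) (s : Fin m) where

  a : ℕ → Fin m
  a = walk b w s

  stepAt-pairing : ∀ k → Pairing (stepAt b w k)
  stepAt-pairing k with even k
  ... | true  = pb
  ... | false = pw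

  stepAt-parity : ∀ i j → even i ≡ even j → stepAt b w i ≡ stepAt b w j
  stepAt-parity i j = cong (λ c → if c then b else w)

  step-b : ∀ k → even k ≡ true → a (suc k) ≡ lookup b (a k)
  step-b k e = cong (λ p → lookup p (a k)) (stepAt-parity k 0 e)

  step-w : ∀ k → even k ≡ false → a (suc k) ≡ lookup w (a k)
  step-w k e = cong (λ p → lookup p (a k)) (stepAt-parity k 1 e)

  back : ∀ k → lookup (stepAt b w k) (a (suc k)) ≡ a k
  back k = Pairing.involutive (stepAt-pairing k) (a k)

  back-parity : ∀ i j → even i ≡ even j → a (suc i) ≡ a (suc j) → a i ≡ a j
  back-parity i j same e = begin
    a i                                     ≡⟨ sym (back i) ⟩
    lookup (stepAt b w i) (a (suc i))       ≡⟨ cong₂ lookup (stepAt-parity i j same) e ⟩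
    lookup (stepAt b w j) (a (suc j))       ≡⟨ back j ⟩
    a j                                     ∎
    where open ≡-Reasoning

  Distinct : ℕ → Set
  Distinct j = ∀ i i′ → i < i′ → i′ < j → a i ≢ a i′

  Revisits : ℕ → Set
  Revisits j = ∃ λ (i : Fin j) → a (toℕ i) ≡ a j

  Distinct-suc : ∀ j → Distinct j → ¬ Revisits j → Distinct (suc j)
  Distinct-suc j d fresh i i′ i<i′ i′<1+j with m≤n⇒m<n∨m≡n (≤-pred i′<1+j)
  ... | inj₁ i′<j = d i i′ i<i′ i′<j
  ... | inj₂ refl = λ e → fresh (fromℕ< i<i′ , trans (cong a (toℕ-fromℕ< i<i′)) e)

  first-revisit : ∀ t → Distinct t ⊎ ∃ λ j → j < t × Distinct j × Revisits j
  first-revisit zero = inj₁ (λ _ _ _ ())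
  first-revisit (suc t) with first-revisit t
  ... | inj₂ (j , j<t , d , r) = inj₂ (j , m<n⇒m<1+n j<t , d , r)
  ... | inj₁ d with any? (λ (i : Fin t) → a (toℕ i) ≟ a t)
  ...   | yes r    = inj₂ (t , n<1+n t , d , r)
  ...   | no fresh = inj₁ (Distinct-suc t d fresh)

  -- The first revisit returns to the start s, after an even number of steps:
  -- walking back from a revisit of equal parity gives an earlier revisit, and
  -- one of opposite parity makes the walk turn back on itself.
  first-revisit-closes : ∀ i j → i < j → a i ≡ a j → Distinct j → i ≡ 0 × even j ≡ true
  first-revisit-closes i (suc j) i<1+j ai≡a1+j d with even i ≟ᵇ even (suc j)
  first-revisit-closes zero     (suc j) i<1+j ai≡a1+j d | yes same = refl , sym same
  first-revisit-closes (suc i) (suc j) i<1+j ai≡a1+j d | yes same =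
    ⊥-elim (d i j (≤-pred i<1+j) (n<1+n j) (back-parity i j (not-injective same) ai≡a1+j))
  first-revisit-closes i (suc j) i<1+j ai≡a1+j d | no differ = ⊥-elim turns-back
    where
    same : even i ≡ even j
    same = trans (¬-not differ) (not-involutive (even j))
    a1+i≡aj : a (suc i) ≡ a j
    a1+i≡aj = trans (cong (lookup (stepAt b w i)) ai≡a1+j) (trans (cong (λ p → lookup p (a (suc j))) (stepAt-parity i j same)) (back j))
    turns-back : ⊥
    turns-back with <-cmp (suc i) j
    ... | tri< 1+i<j _ _ = d (suc i) j 1+i<j (n<1+n j) a1+i≡aj
    ... | tri≈ _ refl _  = not-¬ refl same
    ... | tri> _ _ j<1+i with ≤-antisym (≤-pred j<1+i) (≤-pred i<1+j)
    ...   | refl = Pairing.fixpoint-free (stepAt-pairing i) (a i) a1+i≡aj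

  record Return : Set where
    field
      j        : ℕ
      bounded  : suc j ≤ m
      even-n   : even (suc j) ≡ true
      closes   : a (suc j) ≡ s
      distinct-below : Distinct (suc j)

  -- By the pigeonhole principle the walk revisits a vertex within m steps,
  -- and the first revisit is a return.
  return : Return
  return with first-revisit (suc m)
  ... | inj₁ d with pigeonhole (n<1+n m) (λ (k : Fin (suc m)) → a (toℕ k))
  ...   | i , i′ , i<i′ , e = ⊥-elim (d (toℕ i) (toℕ i′) i<i′ (toℕ<n i′) e)
  return | inj₂ (suc j , n<1+m , d , i , e) with first-revisit-closes (toℕ i) (suc j) (toℕ<n i) e d
  ... | i≡0 , even-n = record
    { j = j ; bounded = ≤-pred n<1+m ; even-n = even-n
    ; closes = trans (sym e) (cong a i≡0) ; distinct-below = d }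

  module Neighbours (j : ℕ) (even-n : even (suc j) ≡ true) (closes : a (suc j) ≡ s) where

    odd-before-n : ∀ k → suc k ≡ suc j → even k ≡ false
    odd-before-n k e = not-injective {y = false} (trans (cong even e) even-n)

    b-move : ∀ k → k < suc j → bIndex k < suc j × lookup b (a k) ≡ a (bIndex k)
    b-move k k<n with even k in ek
    ... | true = ≤∧≢⇒< k<n (λ e → not-¬ {true} refl (trans (sym ek) (odd-before-n k e))) , sym (step-b k ek)
    b-move zero     k<n | false = ⊥-elim (not-¬ {true} refl ek)
    b-move (suc k′) k<n | false = <-trans (n<1+n k′) k<n ,
      trans (cong (lookup b) (step-b k′ (not-injective {y = true} ek))) (Pairing.involutive pb (a k′))

    w-move : ∀ k → k < suc j → wIndex (suc j) k < suc j × lookup w (a k) ≡ a (wIndex (suc j) k)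
    w-move k k<n with even k in ek
    w-move zero     k<n | true = n<1+n j , (begin
      lookup w s                ≡⟨ cong (lookup w) (sym closes) ⟩
      lookup w (a (suc j))      ≡⟨ cong (lookup w) (step-w j (odd-before-n j refl)) ⟩
      lookup w (lookup w (a j)) ≡⟨ Pairing.involutive pw (a j) ⟩
      a j                       ∎)
      where open ≡-Reasoning
    w-move (suc k′) k<n | true = <-trans (n<1+n k′) k<n ,
      trans (cong (lookup w) (step-w k′ (not-injective {y = false} ek))) (Pairing.involutive pw (a k′))
    w-move k        k<n | false with suc k ≡ᵇ suc j in q
    ... | true  = s≤s z≤n , trans (sym (step-w k ek)) (trans (cong a (≡ᵇ⇒≡ (suc k) (suc j) (subst T (sym q) _))) closes)
    ... | false = ≤∧≢⇒< k<n (λ e → subst T q (≡⇒≡ᵇ (suc k) (suc j) e)) , sym (step-w k ek)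

  -- For a connected graph the return happens after exactly m steps, and the
  -- walk is a single polygon through all vertices.
  module _ (conn : T (connected b w)) where
    open Return return
    open Neighbours j even-n closes

    Visited : Fin m → Set
    Visited y = ∃ λ k → k < suc j × a k ≡ y

    reached-visited : ∀ t y → T (iter t (step b w) (s ==_) y) → Visited y
    reached-visited zero y s=y = 0 , s≤s z≤n , ==⇒≡ s=y
    reached-visited (suc t) y reached with ∨⁻ reached
    ... | inj₁ before = reached-visited t y before
    ... | inj₂ via with ∃F⁻ via
    ...   | x , reached-x-edge with reached-visited t x (proj₁ (∧⁻ reached-x-edge))
    ...     | k , k<n , refl with ∨⁻ (proj₂ (∧⁻ reached-x-edge))
    ...       | inj₁ e = bIndex k , proj₁ (b-move k k<n) , trans (sym (proj₂ (b-move k k<n))) (==⇒≡ e)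
    ...       | inj₂ e = wIndex (suc j) k , proj₁ (w-move k k<n) , trans (sym (proj₂ (w-move k k<n))) (==⇒≡ e)

    visited : ∀ y → Visited y
    visited y = reached-visited m y (∀F⁻ (∀F⁻ conn s) y)

    -- All m vertices are among the first n positions, so n = m.
    n≡m : suc j ≡ m
    n≡m = ≤-antisym bounded (injective⇒≤ index-inj)
      where
      index : Fin m → Fin (suc j)
      index y = fromℕ< (proj₁ (proj₂ (visited y)))
      index-inj : ∀ {y y′} → index y ≡ index y′ → y ≡ y′
      index-inj {y} {y′} e = trans (sym (proj₂ (proj₂ (visited y))))
        (trans (cong a (trans (sym (toℕ-fromℕ< _)) (trans (cong toℕ e) (toℕ-fromℕ< _))))
               (proj₂ (proj₂ (visited y′))))

    polygon : Polygon b w s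
    polygon = record
      { cover    = λ y → let (k , k<n , e) = visited y in k , subst (k <_) n≡m k<n , e
      ; distinct = distinct
      ; b-move   = λ k k<m → subst (λ n → bIndex k < n × lookup b (a k) ≡ a (bIndex k)) n≡m
                               (b-move k (subst (k <_) (sym n≡m) k<m))
      ; w-move   = λ k k<m → subst (λ n → wIndex n k < n × lookup w (a k) ≡ a (wIndex n k)) n≡m
                               (w-move k (subst (k <_) (sym n≡m) k<m))
      }
      where
      distinct : ∀ i i′ → i < m → i′ < m → a i ≡ a i′ → i ≡ i′
      distinct i i′ i<m i′<m e with <-cmp i i′
      ... | tri< i<i′ _ _ = ⊥-elim (distinct-below i i′ i<i′ (subst (i′ <_) (sym n≡m) i′<m) e)
      ... | tri≈ _ i≡i′ _ = i≡i′
      ... | tri> _ _ i′<i = ⊥-elim (distinct-below i′ i i′<i (subst (i <_) (sym n≡m) i<m) (sym e))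

polygon : ∀ {m} {b w : Endo m} → Pairing b → Pairing w → T (connected b w) → ∀ s → Polygon b w s
polygon pb pw conn s = Walk.polygon pb pw s conn

-- Rooting maps on a fixed single polygon (B , W).
module Rooting {K : ℕ} {B W : Endo (suc K)} (pB : Pairing B) (pW : Pairing W) (cBW : T (connected B W)) where

  N : ℕ
  N = suc K

  open Polygon (polygon pB pW cBW fz) using (cover; distinct; b-move; w-move)

  pos : Fin N → ℕ
  pos y = proj₁ (cover y)

  pos<N : ∀ y → pos y < N
  pos<N y = proj₁ (proj₂ (cover y))

  walk-pos : ∀ y → walk B W fz (pos y) ≡ y
  walk-pos y = proj₂ (proj₂ (cover y))

  pos-walk : ∀ k → k < N → pos (walk B W fz k) ≡ k
  pos-walk k k<N = distinct (pos (walk B W fz k)) k (pos<N _) k<N (walk-pos _)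

  -- The relabelling matching the walk along B , W from 0 with the walk
  -- along b , w from x, vertex by vertex.
  matching : Endo N → Endo N → Fin N → Endo N
  matching b w x = tabulate (λ y → walk b w x (pos y))

  matching-lookup : ∀ b w x y → lookup (matching b w x) y ≡ walk b w x (pos y)
  matching-lookup b w x = lookup∘tabulate (λ y → walk b w x (pos y))

  matching-walk : ∀ b w x k → k < N → lookup (matching b w x) (walk B W fz k) ≡ walk b w x k
  matching-walk b w x k k<N = trans (matching-lookup b w x _) (cong (walk b w x) (pos-walk k k<N))

  matching-unique : ∀ σ b w → Carries σ B b → Carries σ W w → matching b w (lookup σ fz) ≡ σ
  matching-unique σ b w cb cw = vec-ext (λ y →
    trans (matching-lookup b w (lookup σ fz) y) (trans (walk-relabel σ B W b w cb cw fz (pos y)) (cong (lookup σ) (walk-pos y))))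

  -- When (b , w) is a single polygon too, the matching rooted at x is a
  -- relabelling carrying B , W to b , w and 0 to x: both walks have their
  -- neighbours at the same positions.
  module Matching {b w : Endo N} (pb : Pairing b) (pw : Pairing w) (cbw : T (connected b w)) (x : Fin N) where
    private module P = Polygon (polygon pb pw cbw x)

    ρ : Endo N
    ρ = matching b w x

    injective : Inj ρ
    injective y y′ e = begin
      y                       ≡⟨ sym (walk-pos y) ⟩
      walk B W fz (pos y)     ≡⟨ cong (walk B W fz) (P.distinct _ _ (pos<N y) (pos<N y′) ρy≡ρy′) ⟩
      walk B W fz (pos y′)    ≡⟨ walk-pos y′ ⟩
      y′                      ∎
      where
      open ≡-Reasoning
      ρy≡ρy′ : walk b w x (pos y) ≡ walk b w x (pos y′)
      ρy≡ρy′ = trans (sym (matching-lookup b w x y)) (trans e (matching-lookup b w x y′))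

    carries-along : ∀ (P p : Endo N) (next : ℕ → ℕ) →
      (∀ k → k < N → next k < N × lookup P (walk B W fz k) ≡ walk B W fz (next k)) →
      (∀ k → k < N → lookup p (walk b w x k) ≡ walk b w x (next k)) → Carries ρ P p
    carries-along P p next P-move p-move y = subst (λ y → lookup p (lookup ρ y) ≡ lookup ρ (lookup P y))
      (walk-pos y) (at (pos y) (pos<N y))
      where
      open ≡-Reasoning
      at : ∀ k → k < N → lookup p (lookup ρ (walk B W fz k)) ≡ lookup ρ (lookup P (walk B W fz k))
      at k k<N = begin
        lookup p (lookup ρ (walk B W fz k))    ≡⟨ cong (lookup p) (matching-walk b w x k k<N) ⟩
        lookup p (walk b w x k)                ≡⟨ p-move k k<N ⟩
        walk b w x (next k)                    ≡⟨ sym (matching-walk b w x (next k) (proj₁ (P-move k k<N))) ⟩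
        lookup ρ (walk B W fz (next k))        ≡⟨ cong (lookup ρ) (sym (proj₂ (P-move k k<N))) ⟩
        lookup ρ (lookup P (walk B W fz k))    ∎

    carries-B : Carries ρ B b
    carries-B = carries-along B b bIndex b-move (λ k k<N → proj₂ (P.b-move k k<N))

    carries-W : Carries ρ W w
    carries-W = carries-along W w (wIndex N) w-move (λ k k<N → proj₂ (P.w-move k k<N))

    root : lookup ρ fz ≡ x
    root = matching-walk b w x 0 (s≤s z≤n)

  module DoubleCount (M : Triple N) where

    labelled : Endo N × Endo N → Bool
    labelled (σ , e) = isPerm σ ∧ isoMap (B , W , e) M

    polygonalCopy : Triple N → Bool
    polygonalCopy (b , w , e) = connected b w ∧ isoMap (b , w , e) M

    rooted : Triple N × Fin N → Bool
    rooted (t , x) = polygonalCopy t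

    labelledList : List (Endo N × Endo N)
    labelledList = cartesianProduct (allVecs N) (pairings N)

    rootedList : List (Triple N × Fin N)
    rootedList = cartesianProduct (maps N) (allFin N)

    toRooted : Endo N × Endo N → Triple N × Fin N
    toRooted (σ , e) = (relabel σ B , relabel σ W , relabel σ e) , lookup σ fz

    toLabelled : Triple N × Fin N → Endo N × Endo N
    toLabelled ((b , w , e) , x) = matching b w x , pullback (matching b w x) e

    module FromLabelled {σ e : Endo N} (mem : (σ , e) ∈ labelledList) (t : T (labelled (σ , e))) where
      inj : Inj σ
      inj = injective⁻ σ (proj₁ (∧⁻ {isPerm σ} t))
      pe : Pairing e
      pe = ∈-pairings⁻ (proj₂ (∈-cartesianProduct⁻ (allVecs N) (pairings N) mem))
      iso-M : Iso (B , W , e) M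
      iso-M = iso⁻ (B , W , e) M (proj₂ (∧⁻ {isPerm σ} t))
      σB σW σe : Endo N
      σB = relabel σ B
      σW = relabel σ W
      σe = relabel σ e
      cB : Carries σ B σB
      cB = relabel-carries σ B inj
      cW : Carries σ W σW
      cW = relabel-carries σ W inj
      ce : Carries σ e σe
      ce = relabel-carries σ e inj

    module FromRooted {b w e : Endo N} {x : Fin N} (mem : ((b , w , e) , x) ∈ rootedList)
                      (t : T (rooted ((b , w , e) , x))) where
      pairings-bwe : Pairing b × Pairing w × Pairing e
      pairings-bwe = ∈-maps⁻ (proj₁ (∈-cartesianProduct⁻ (maps N) (allFin N) mem))
      pe : Pairing e
      pe = proj₂ (proj₂ pairings-bwe)
      iso-M : Iso (b , w , e) M
      iso-M = iso⁻ (b , w , e) M (proj₂ (∧⁻ {connected b w} t))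
      open Matching (proj₁ pairings-bwe) (proj₁ (proj₂ pairings-bwe)) (proj₁ (∧⁻ {connected b w} t)) x public
      ce : Carries ρ (pullback ρ e) e
      ce = pullback-carries ρ e injective

    toRooted-ok : ∀ z → z ∈ labelledList → T (labelled z) → toRooted z ∈ rootedList × T (rooted (toRooted z))
    toRooted-ok (σ , e) mem t =
      ∈-cartesianProduct⁺ (∈-maps⁺ (pairing-push σ B σB inj cB pB) (pairing-push σ W σW inj cW pW) (pairing-push σ e σe inj ce pe))
                          (∈-allFin _) ,
      ∧⁺ (connected-relabel σ B W σB σW inj cB cW cBW)
         (iso⁺ (σB , σW , σe) M (iso-trans (σB , σW , σe) (B , W , e) M (iso-sym (B , W , e) (σB , σW , σe) (σ , inj , cB , cW , ce)) iso-M))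
      where open FromLabelled mem t

    toLabelled-ok : ∀ z → z ∈ rootedList → T (rooted z) → toLabelled z ∈ labelledList × T (labelled (toLabelled z))
    toLabelled-ok ((b , w , e) , x) mem t =
      ∈-cartesianProduct⁺ (allVecs-complete ρ) (∈-pairings⁺ (pairing-pullback ρ (pullback ρ e) e injective ce pe)) ,
      ∧⁺ (injective⁺ ρ injective)
         (iso⁺ (B , W , pullback ρ e) M (iso-trans (B , W , pullback ρ e) (b , w , e) M (ρ , injective , carries-B , carries-W , ce) iso-M))
      where open FromRooted mem t

    toLabelled∘toRooted : ∀ z → z ∈ labelledList → T (labelled z) → toLabelled (toRooted z) ≡ z
    toLabelled∘toRooted (σ , e) mem t = cong₂ _,_ matching≡σ (trans (cong (λ ρ → pullback ρ (relabel σ e)) matching≡σ)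
                                                            (pullback-unique σ e σe inj ce))
      where
      open FromLabelled mem t
      matching≡σ : matching (relabel σ B) (relabel σ W) (lookup σ fz) ≡ σ
      matching≡σ = matching-unique σ σB σW cB cW

    toRooted∘toLabelled : ∀ z → z ∈ rootedList → T (rooted z) → toRooted (toLabelled z) ≡ z
    toRooted∘toLabelled ((b , w , e) , x) mem t =
      cong₂ _,_ (cong₂ _,_ (relabel-unique ρ B b injective carries-B)
                  (cong₂ _,_ (relabel-unique ρ W w injective carries-W) (relabel-unique ρ (pullback ρ e) e injective ce)))
                root
      where open FromRooted mem t

    labelled≡rooted : count labelled labelledList ≡ count rooted rootedList
    labelled≡rooted = count-bijection
      (≡-dec× (≡-decᵥ _≟_) (≡-decᵥ _≟_)) (≡-dec× (≡-dec× (≡-decᵥ _≟_) (≡-dec× (≡-decᵥ _≟_) (≡-decᵥ _≟_))) _≟_)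
      labelled rooted labelledList rootedList
      (cartesianProduct⁺ (allVecs-unique N) (pairings-unique N)) (cartesianProduct⁺ (maps-unique N) (allFin⁺ N))
      toRooted toLabelled toRooted-ok toLabelled-ok toLabelled∘toRooted toRooted∘toLabelled

    count-labelled : count labelled labelledList ≡ N ! * rhsCount B W M
    count-labelled = begin
      count labelled labelledList                            ≡⟨ count-cartesianProduct isPerm (λ e → isoMap (B , W , e) M) (allVecs N) (pairings N) ⟩
      count isPerm (allVecs N) * rhsCount B W M              ≡⟨ cong (_* rhsCount B W M) (permutations-count N) ⟩
      N ! * rhsCount B W M                                   ∎
      where open ≡-Reasoning

    count-rooted : count rooted rootedList ≡ lhsCoeff M * N
    count-rooted = begin
      count rooted rootedList                   ≡⟨ count-cartesianProductˡ polygonalCopy (maps N) (allFin N) ⟩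
      count polygonalCopy (maps N) * length (allFin N) ≡⟨ cong (lhsCoeff M *_) (length-tabulate {n = N} (λ x → x)) ⟩
      lhsCoeff M * N                            ∎
      where open ≡-Reasoning

    double-count : lhsCoeff M * N ≡ (K ! * rhsCount B W M) * N
    double-count = begin
      lhsCoeff M * N                    ≡⟨ sym count-rooted ⟩
      count rooted rootedList           ≡⟨ sym labelled≡rooted ⟩
      count labelled labelledList       ≡⟨ count-labelled ⟩
      (N * K !) * rhsCount B W M        ≡⟨ *-assoc N (K !) (rhsCount B W M) ⟩
      N * (K ! * rhsCount B W M)        ≡⟨ *-comm N (K ! * rhsCount B W M) ⟩
      (K ! * rhsCount B W M) * N        ∎
      where open ≡-Reasoning

proposition1p3 : (n : ℕ) → 1 ≤ n → (B W : Endo (2 * n)) → T (isPairing B) → T (isPairing W) → T (connected B W) → (M : Triple (2 * n)) → T (isMap M) → lhsCoeff M ≡ ((2 * n ∸ 1) !) * rhsCount B W M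
proposition1p3 (suc n) _ B W isPairing-B isPairing-W connected-BW M _ =
  *-cancelʳ-≡ (lhsCoeff M) _ (2 * suc n) (DoubleCount.double-count M)
  where open Rooting (pairing⁻ {p = B} isPairing-B) (pairing⁻ {p = W} isPairing-W) connected-BW
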